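{- Let $k\geq 1$ and $\ell\geq 3$ be integers and let $G$ be a graph of minimum degree at least $k\ell-1$. Then $G$ contains $k$ pairwise vertex-disjoint cycles, each of length at least $\ell$.
   Context: Graphs are finite and simple. -}

module Defs where

open import Data.Nat using (ℕ; _≤_)
open import Data.Bool using (Bool; true; false)
open import Data.Fin using (Fin)
open import Data.Fin.Subset using (∣_∣)
open import Data.Vec using (tabulate)
open import Data.List using (List; _∷_; []; _++_; length)
open import Data.List.Relation.Unary.Unique.Propositional using (Unique)
open import Data.List.Relation.Unary.Linked using (Linked)
open import Data.List.Membership.Propositional using (_∈_)
open import Relation.Binary.PropositionalEquality using (_≡_)
open import Relation.Nullary using (¬_)

record Graph (n : ℕ) : Set where
  field
    adj    : Fin n → Fin n → Bool
    sym    : ∀ u v → adj u v ≡ adj v u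
    irrefl : ∀ v → adj v v ≡ false

open Graph public

Adj : ∀ {n} → Graph n → Fin n → Fin n → Set
Adj G u v = adj G u v ≡ true

degree : ∀ {n} → Graph n → Fin n → ℕ
degree G v = ∣ tabulate (adj G v) ∣

-- A cycle in G: a list of pairwise distinct vertices x ∷ xs of length ≥ 3
-- in which consecutive vertices are adjacent, and the last vertex is
-- adjacent to the first one (x ∷ xs ++ [x] is a closed walk).
record Cycle {n : ℕ} (G : Graph n) : Set where
  field
    start    : Fin n
    rest     : List (Fin n)
    distinct : Unique (start ∷ rest)
    long     : 2 ≤ length rest
    edges    : Linked (Adj G) (start ∷ (rest ++ (start ∷ [])))

open Cycle public

vertices : ∀ {n} {G : Graph n} → Cycle G → List (Fin n)
vertices C = start C ∷ rest C

cycleLength : ∀ {n} {G : Graph n} → Cycle G → ℕ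
cycleLength C = length (vertices C)

Disjoint : ∀ {n} {G : Graph n} → Cycle G → Cycle G → Set
Disjoint C D = ∀ v → v ∈ vertices C → ¬ (v ∈ vertices D)

module Submission where

-- Write ℓ = d + 1 and remove long cycles greedily, keeping the invariant that every vertex
-- outside the removed set X has at least (r + 1)ℓ − 1 neighbours outside X when r + 1 cycles
-- are still wanted.  A maximal path in G − X ends in a vertex with at least ℓ − 1 neighbours
-- on the path, which closes a cycle of length at least ℓ.  Shorten this cycle while possible:
-- if its start vertex has ℓ neighbours on it, or a vertex outside has ℓ + 1, a shorter cycle
-- of length at least ℓ runs through them.  Once no shortcut exists, deleting the cycle costs
-- every other vertex at most ℓ neighbours, so the invariant passes to the remaining r cycles,
-- and the start vertex, with at most ℓ − 1 neighbours on the cycle, keeps one outside it.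

open import Defs
open import Data.Nat using (ℕ; _≤_; _<_; _*_; _∸_)
open import Data.Fin using (Fin)
open import Data.Product using (∃; _×_)
open import Relation.Binary.PropositionalEquality using (_≢_)

open import Data.Nat using (zero; suc; _+_; z≤n; s≤s; _<?_)
open import Data.Nat.Properties
  using ( ≤-trans; ≤-refl; ≤-pred; ≮⇒≥; 1+n≰n; +-assoc; +-comm; +-suc; m≤m+n; m≤n+m
        ; +-monoʳ-≤; +-cancelʳ-≤; module ≤-Reasoning)
open import Data.Nat.Induction using (<-wellFounded)
open import Induction.WellFounded using (Acc; acc)
open import Data.Fin using (zero; suc; _≟_)
open import Data.Fin.Properties using (any?)
open import Data.Fin.Subset using (∣_∣)
open import Data.Bool.Properties using (T-≡)
import Data.Vec as Vec
open import Data.List using (List; []; _∷_; _++_; [_]; length; filter; allFin)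
import Data.List as List
open import Data.List.Properties
  using ( length-++; length-filter; length-tabulate; length-removeAt′
        ; filter-all; filter-accept; filter-reject)
open import Data.List.Relation.Unary.All as All using (All; []; _∷_)
open import Data.List.Relation.Unary.All.Properties using (anti-mono) renaming (++⁻ˡ to All-++⁻ˡ)
open import Data.List.Relation.Unary.AllPairs using (AllPairs; []; _∷_)
open import Data.List.Relation.Unary.Any using (here; there; index; _─_)
open import Data.List.Relation.Unary.Linked as Linked using (Linked; []; [-]; _∷_)
open import Data.List.Relation.Unary.Unique.Propositional using (Unique)
open import Data.List.Relation.Unary.Unique.Propositional.Properties using (allFin⁺; filter⁺)
open import Data.List.Relation.Binary.Subset.Propositional using (_⊆_)
open import Data.List.Membership.Propositional using (_∈_; _∉_)
open import Data.List.Membership.Propositional.Properties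
  using (∈-allFin; ∈-++⁺ˡ; ∈-++⁺ʳ; ∈-++⁻; ∈-filter⁺; ∈-filter⁻)
import Data.List.Membership.DecPropositional as DecMembership
open import Data.Product using (Σ; ∃₂; _,_; proj₁; proj₂)
open import Data.Sum using ([_,_]′)
open import Data.Empty using (⊥-elim)
open import Function using (_∘_; id)
open import Function.Bundles using (Equivalence)
open import Relation.Binary.PropositionalEquality as ≡ using (_≡_; refl; cong; subst)
open import Relation.Nullary using (¬_; Dec; yes; no; does; map′; T?; _×-dec_)
open import Relation.Nullary.Decidable using (decidable-stable)
open import Relation.Unary using (Decidable)

m+[n+o]≤p≤q+n⇒m+o≤q : ∀ m n o {p q} → m + (n + o) ≤ p → p ≤ q + n → m + o ≤ q
m+[n+o]≤p≤q+n⇒m+o≤q m n o {q = q} m+[n+o]≤p p≤q+n = +-cancelʳ-≤ n (m + o) q (begin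
  m + o + n    ≡⟨ +-assoc m o n ⟩
  m + (o + n)  ≡⟨ cong (m +_) (+-comm o n) ⟩
  m + (n + o)  ≤⟨ m+[n+o]≤p ⟩
  _            ≤⟨ p≤q+n ⟩
  q + n        ∎)
  where open ≤-Reasoning

module _ {A : Set} where

  0<length⇒∃∈ : ∀ {xs : List A} → 0 < length xs → ∃ (_∈ xs)
  0<length⇒∃∈ {x ∷ _} _ = x , here refl

  ∉⇒Unique-∷ : ∀ {x : A} {xs} → x ∉ xs → Unique xs → Unique (x ∷ xs)
  ∉⇒Unique-∷ x∉xs xs! = All.tabulate (λ y∈xs x≡y → x∉xs (subst (_∈ _) (≡.sym x≡y) y∈xs)) ∷ xs!

  ∈-─⁺ : ∀ {x y : A} {ys} (x∈ys : x ∈ ys) → y ∈ ys → y ≢ x → y ∈ (ys ─ x∈ys)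
  ∈-─⁺ (here refl) (here refl) y≢x = ⊥-elim (y≢x refl)
  ∈-─⁺ (here refl) (there y∈ys) _  = y∈ys
  ∈-─⁺ (there _)   (here refl) _   = here refl
  ∈-─⁺ (there x∈ys) (there y∈ys) y≢x = there (∈-─⁺ x∈ys y∈ys y≢x)

  Unique-⊆⇒length-≤ : ∀ {xs ys : List A} → Unique xs → xs ⊆ ys → length xs ≤ length ys
  Unique-⊆⇒length-≤ [] _ = z≤n
  Unique-⊆⇒length-≤ {ys = ys} (x≢xs ∷ xs!) xs⊆ys =
    subst (_ ≤_) (≡.sym (length-removeAt′ ys (index x∈ys)))
      (s≤s (Unique-⊆⇒length-≤ xs! (λ y∈xs →
        ∈-─⁺ x∈ys (xs⊆ys (there y∈xs)) (All.lookup x≢xs y∈xs ∘ ≡.sym))))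
    where x∈ys = xs⊆ys (here refl)

  module _ {R : A → A → Set} where

    AllPairs-++⁻ˡ : ∀ xs {ys} → AllPairs R (xs ++ ys) → AllPairs R xs
    AllPairs-++⁻ˡ []       _          = []
    AllPairs-++⁻ˡ (x ∷ xs) (x~ ∷ xs~) = All-++⁻ˡ xs x~ ∷ AllPairs-++⁻ˡ xs xs~

    AllPairs-++⁻ʳ : ∀ xs {ys} → AllPairs R (xs ++ ys) → AllPairs R ys
    AllPairs-++⁻ʳ []       xs~       = xs~
    AllPairs-++⁻ʳ (x ∷ xs) (_ ∷ xs~) = AllPairs-++⁻ʳ xs xs~

    Linked-++⁻ˡ : ∀ xs {ys} → Linked R (xs ++ ys) → Linked R xs
    Linked-++⁻ˡ []           _          = []
    Linked-++⁻ˡ (x ∷ [])     _          = [-]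
    Linked-++⁻ˡ (x ∷ y ∷ xs) (x~y ∷ l) = x~y ∷ Linked-++⁻ˡ (y ∷ xs) l

    Linked-++⁻ʳ : ∀ xs {ys} → Linked R (xs ++ ys) → Linked R ys
    Linked-++⁻ʳ []       l = l
    Linked-++⁻ʳ (x ∷ xs) l = Linked-++⁻ʳ xs (Linked.tail l)

  module _ {P : A → Set} (P? : Decidable P) where

    ∣tabulate∣≡length-filter : ∀ {m} (f : Fin m → A) →
      ∣ Vec.tabulate (λ i → does (P? (f i))) ∣ ≡ length (filter P? (List.tabulate f))
    ∣tabulate∣≡length-filter {zero}  f = refl
    ∣tabulate∣≡length-filter {suc m} f with P? (f zero)
    ... | yes _ = cong suc (∣tabulate∣≡length-filter (f ∘ suc))
    ... | no  _ = ∣tabulate∣≡length-filter (f ∘ suc)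

module _ {n : ℕ} (G : Graph n) where

  open DecMembership (_≟_ {n}) using (_∈?_; _∉?_)

  -- Built from T? so that does (Adj? u v) is definitionally adj G u v, which degree counts.
  Adj? : ∀ u v → Dec (Adj G u v)
  Adj? u v = map′ (Equivalence.to T-≡) (Equivalence.from T-≡) (T? (adj G u v))

  Adj-sym : ∀ {u v} → Adj G u v → Adj G v u
  Adj-sym {u} {v} u~v = ≡.trans (Graph.sym G v u) u~v

  Adj-irrefl : ∀ {v} → ¬ Adj G v v
  Adj-irrefl {v} v~v with () ← ≡.trans (≡.sym v~v) (irrefl G v)

  neighbours : Fin n → List (Fin n)
  neighbours v = filter (Adj? v) (allFin n)

  degreeOn : Fin n → List (Fin n) → ℕ
  degreeOn x L = length (filter (Adj? x) L)

  degreeOutside : List (Fin n) → Fin n → ℕ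
  degreeOutside X v = length (filter (_∉? X) (neighbours v))

  degree≡degreeOutside[] : ∀ v → degree G v ≡ degreeOutside [] v
  degree≡degreeOutside[] v = ≡.trans (∣tabulate∣≡length-filter (Adj? v) id)
    (cong length (≡.sym (filter-all (_∉? []) {neighbours v} (All.tabulate (λ _ ())))))

  Unique⇒length≤n : ∀ {L} → Unique L → length L ≤ n
  Unique⇒length≤n {L} L! = subst (length L ≤_) (length-tabulate {n = n} id)
    (Unique-⊆⇒length-≤ {ys = allFin n} L! (λ {u} _ → ∈-allFin u))

  Unique-neighboursOutside : ∀ X v → Unique (filter (_∉? X) (neighbours v))
  Unique-neighboursOutside X v =
    filter⁺ (_∉? X) {neighbours v} (filter⁺ (Adj? v) {allFin n} (allFin⁺ n))

  degreeOutside-++ : ∀ L X v → degreeOutside X v ≤ degreeOutside (L ++ X) v + degreeOn v L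
  degreeOutside-++ L X v =
    subst (degreeOutside X v ≤_)
      (length-++ (filter (_∉? L ++ X) (neighbours v)) {filter (Adj? v) L})
    (Unique-⊆⇒length-≤ (Unique-neighboursOutside X v) split)
    where
    split : filter (_∉? X) (neighbours v) ⊆ filter (_∉? L ++ X) (neighbours v) ++ filter (Adj? v) L
    split {u} u∈ with ∈-filter⁻ (_∉? X) {xs = neighbours v} u∈
    ... | u∈N , u∉X with u ∈? L
    ...   | yes u∈L = ∈-++⁺ʳ (filter (_∉? L ++ X) (neighbours v))
                        (∈-filter⁺ (Adj? v) u∈L (proj₂ (∈-filter⁻ (Adj? v) {xs = allFin n} u∈N)))
    ...   | no  u∉L = ∈-++⁺ˡ (∈-filter⁺ (_∉? L ++ X) u∈N ([ u∉L , u∉X ]′ ∘ ∈-++⁻ L))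

  degreeOn-∷⁺ : ∀ {x b} L → Adj G x b → degreeOn x (b ∷ L) ≡ suc (degreeOn x L)
  degreeOn-∷⁺ L x~b = cong length (filter-accept (Adj? _) {xs = L} x~b)

  degreeOn-∷⁻ : ∀ {x b} L → ¬ Adj G x b → degreeOn x (b ∷ L) ≡ degreeOn x L
  degreeOn-∷⁻ L x≁b = cong length (filter-reject (Adj? _) {xs = L} x≁b)

  firstNeighbour : ∀ x Q k → suc k ≤ degreeOn x Q →
    ∃₂ λ pre a → ∃ λ Q′ → Q ≡ pre ++ a ∷ Q′ × Adj G x a × k ≤ degreeOn x Q′
  firstNeighbour x []      k ()
  firstNeighbour x (b ∷ Q) k h with Adj? x b
  ... | yes x~b = [] , b , Q , refl , x~b , ≤-pred (subst (suc k ≤_) (degreeOn-∷⁺ Q x~b) h)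
  ... | no  x≁b with firstNeighbour x Q k (subst (suc k ≤_) (degreeOn-∷⁻ Q x≁b) h)
  ...   | pre , a , Q′ , refl , x~a , h′ = b ∷ pre , a , Q′ , refl , x~a , h′

  prefixWithNeighbours : ∀ x a Q j r → Linked (Adj G) (a ∷ Q) → suc j + r ≤ degreeOn x Q →
    ∃₂ λ P S → Q ≡ P ++ S × Linked (Adj G) (a ∷ P ++ [ x ]) ×
               suc j ≤ degreeOn x P × r ≤ degreeOn x S
  prefixWithNeighbours x a []      j r _ ()
  prefixWithNeighbours x a (b ∷ Q) j r (a~b ∷ l) h with Adj? x b | j
  ... | yes x~b | zero   =
    [ b ] , Q , refl , a~b ∷ Adj-sym x~b ∷ [-] ,
    subst (1 ≤_) (≡.sym (degreeOn-∷⁺ [] x~b)) ≤-refl ,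
    ≤-pred (subst (suc r ≤_) (degreeOn-∷⁺ Q x~b) h)
  ... | yes x~b | suc j′
    with prefixWithNeighbours x b Q j′ r l
           (≤-pred (subst (suc (suc j′) + r ≤_) (degreeOn-∷⁺ Q x~b) h))
  ...   | P , S , refl , l′ , cP , cS =
    b ∷ P , S , refl , a~b ∷ l′ , subst (suc (suc j′) ≤_) (≡.sym (degreeOn-∷⁺ P x~b)) (s≤s cP) , cS
  prefixWithNeighbours x a (b ∷ Q) _ r (a~b ∷ l) h | no x≁b | j
    with prefixWithNeighbours x b Q j r l (subst (suc j + r ≤_) (degreeOn-∷⁻ Q x≁b) h)
  ...   | P , S , refl , l′ , cP , cS =
    b ∷ P , S , refl , a~b ∷ l′ , subst (suc j ≤_) (≡.sym (degreeOn-∷⁻ P x≁b)) cP , cS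

  -- The cycle leaves x to its first neighbour on Q and follows Q up to its k-th neighbour;
  -- the r neighbours beyond it lie outside the cycle.
  cycleThroughNeighbours : ∀ {x Q} → Unique (x ∷ Q) → Linked (Adj G) Q →
    ∀ k r → 2 ≤ k → k + r ≤ degreeOn x Q →
    Σ (Cycle G) λ C → vertices C ⊆ x ∷ Q × k < cycleLength C × r + cycleLength C ≤ length (x ∷ Q)
  cycleThroughNeighbours {x} {Q} (x∉Q ∷ Q!) linQ (suc (suc j)) r (s≤s (s≤s z≤n)) h
    with firstNeighbour x Q (suc j + r) h
  ... | pre , a , Q′ , refl , x~a , h′
    with prefixWithNeighbours x a Q′ j r (Linked-++⁻ʳ pre linQ) h′
  ... | P , S , refl , linP , cP , cS = C , C⊆xQ , s≤s (s≤s |P|>j) , r+|C|≤|xQ|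
    where
    aP⊆Q : a ∷ P ⊆ pre ++ a ∷ P ++ S
    aP⊆Q = ∈-++⁺ʳ pre ∘ ∈-++⁺ˡ
    |P|>j : suc j ≤ length P
    |P|>j = ≤-trans cP (length-filter (Adj? x) P)
    C : Cycle G
    C = record
      { start    = x
      ; rest     = a ∷ P
      ; distinct = anti-mono aP⊆Q x∉Q ∷ AllPairs-++⁻ˡ (a ∷ P) (AllPairs-++⁻ʳ pre Q!)
      ; long     = s≤s (≤-trans (s≤s z≤n) |P|>j)
      ; edges    = x~a ∷ linP
      }
    C⊆xQ : vertices C ⊆ x ∷ pre ++ a ∷ P ++ S
    C⊆xQ (here refl) = here refl
    C⊆xQ (there y∈)  = there (aP⊆Q y∈)
    open ≤-Reasoning
    r+|C|≤|xQ| : r + cycleLength C ≤ length (x ∷ pre ++ a ∷ P ++ S)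
    r+|C|≤|xQ| = begin
      r + length (x ∷ a ∷ P)                 ≡⟨ +-comm r _ ⟩
      length (x ∷ a ∷ P) + r                 ≤⟨ +-monoʳ-≤ _ (≤-trans cS (length-filter (Adj? x) S)) ⟩
      length (x ∷ a ∷ P) + length S          ≡⟨ ≡.sym (length-++ (x ∷ a ∷ P)) ⟩
      length (x ∷ a ∷ P ++ S)                ≤⟨ s≤s (m≤n+m _ (length pre)) ⟩
      suc (length pre + length (a ∷ P ++ S)) ≡⟨ cong suc (≡.sym (length-++ pre)) ⟩
      length (x ∷ pre ++ a ∷ P ++ S)         ∎

  PathOutside : List (Fin n) → List (Fin n) → Set
  PathOutside X p = Unique p × Linked (Adj G) p × All (_∉ X) p

  -- f bounds the number of extensions still possible, as a path has at most n vertices.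
  maximalPath : ∀ X f v t → n ≤ f + length (v ∷ t) → PathOutside X (v ∷ t) →
    ∃₂ λ v′ t′ → PathOutside X (v′ ∷ t′) × (∀ {u} → Adj G v′ u → u ∉ X → u ∈ v′ ∷ t′)
  maximalPath X f v t bound p@(p! , linp , p∉X)
    with any? (λ u → Adj? v u ×-dec u ∉? X ×-dec u ∉? v ∷ t)
  ... | no cannotExtend =
    v , t , p , λ v~u u∉X →
      decidable-stable (_ ∈? v ∷ t) (λ u∉p → cannotExtend (_ , v~u , u∉X , u∉p))
  ... | yes (u , v~u , u∉X , u∉p) with f
  ...   | zero   = ⊥-elim (1+n≰n (≤-trans (Unique⇒length≤n (∉⇒Unique-∷ u∉p p!)) bound))
  ...   | suc f′ = maximalPath X f′ u (v ∷ t) (subst (n ≤_) (≡.sym (+-suc f′ _)) bound)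
                     (∉⇒Unique-∷ u∉p p! , Adj-sym v~u ∷ linp , u∉X ∷ p∉X)

  Linked-vertices : (C : Cycle G) → Linked (Adj G) (vertices C)
  Linked-vertices C = Linked-++⁻ˡ (vertices C) (edges C)

  vertexOutside : ∀ X v → 0 < degreeOutside X v → ∃ (_∉ X)
  vertexOutside X v pos with 0<length⇒∃∈ pos
  ... | u , u∈ = u , proj₂ (∈-filter⁻ (_∉? X) {xs = neighbours v} u∈)

  module _ (d : ℕ) (2≤d : 2 ≤ d) where

    record LongCycleOutside (X : List (Fin n)) : Set where
      field
        cycle  : Cycle G
        isLong : d < cycleLength cycle
        avoids : All (_∉ X) (vertices cycle)

    open LongCycleOutside

    longCycleThroughNeighbours : ∀ {X x Q} r →
      Unique (x ∷ Q) → Linked (Adj G) Q → All (_∉ X) (x ∷ Q) → r + d ≤ degreeOn x Q →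
      Σ (LongCycleOutside X) λ C → r + cycleLength (cycle C) ≤ length (x ∷ Q)
    longCycleThroughNeighbours {x = x} {Q} r xQ! linQ xQ∉X h =
      let (C , C⊆xQ , long , short) =
            cycleThroughNeighbours xQ! linQ d r 2≤d (subst (_≤ degreeOn x Q) (+-comm r d) h)
      in record { cycle = C ; isLong = long ; avoids = anti-mono C⊆xQ xQ∉X } , short

    longCycleFrom : ∀ {X w} → w ∉ X → (∀ {v} → v ∉ X → d ≤ degreeOutside X v) → LongCycleOutside X
    longCycleFrom {X} {w} w∉X deg with maximalPath X n w [] (m≤m+n n 1) ([] ∷ [] , [-] , w∉X ∷ [])
    ... | v , t , (vt! , linvt , vt∉X) , maximal =
      proj₁ (longCycleThroughNeighbours 0 vt! (Linked.tail linvt) vt∉X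
               (≤-trans (deg (All.head vt∉X)) deg≤))
      where
      neighboursOutside⊆t : filter (_∉? X) (neighbours v) ⊆ filter (Adj? v) t
      neighboursOutside⊆t {u} u∈ with ∈-filter⁻ (_∉? X) {xs = neighbours v} u∈
      ... | u∈N , u∉X with ∈-filter⁻ (Adj? v) {xs = allFin n} u∈N
      ...   | _ , v~u with maximal v~u u∉X
      ...     | here refl = ⊥-elim (Adj-irrefl v~u)
      ...     | there u∈t = ∈-filter⁺ (Adj? v) u∈t v~u
      deg≤ : degreeOutside X v ≤ degreeOn v t
      deg≤ = Unique-⊆⇒length-≤ (Unique-neighboursOutside X v) neighboursOutside⊆t

    -- The two properties of a shortest long cycle in G − X that the argument uses.
    Unshortenable : List (Fin n) → Cycle G → Set
    Unshortenable X C = degreeOn (start C) (rest C) ≤ d ×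
                        (∀ {x} → x ∉ X → x ∉ vertices C → degreeOn x (vertices C) ≤ suc d)

    ShorterThan : ∀ {X} → LongCycleOutside X → Set
    ShorterThan {X} C = Σ (LongCycleOutside X) λ C′ → cycleLength (cycle C′) < cycleLength (cycle C)

    shortcutAtStart : ∀ {X} (C : LongCycleOutside X) →
      d < degreeOn (start (cycle C)) (rest (cycle C)) → ShorterThan C
    shortcutAtStart C big = longCycleThroughNeighbours 1
      (distinct (cycle C)) (Linked.tail (Linked-vertices (cycle C))) (avoids C) big

    shortcutThrough : ∀ {X x} (C : LongCycleOutside X) → x ∉ X → x ∉ vertices (cycle C) →
      suc d < degreeOn x (vertices (cycle C)) → ShorterThan C
    shortcutThrough C x∉X x∉C big =
      let (C′ , 2+|C′|≤1+|C|) = longCycleThroughNeighbours 2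
            (∉⇒Unique-∷ x∉C (distinct (cycle C))) (Linked-vertices (cycle C)) (x∉X ∷ avoids C) big
      in C′ , ≤-pred 2+|C′|≤1+|C|

    unshortenable : ∀ {X} (C : LongCycleOutside X) → Acc _<_ (cycleLength (cycle C)) →
      Σ (LongCycleOutside X) (Unshortenable X ∘ cycle)
    unshortenable {X} C (acc shorter)
      with d <? degreeOn (start (cycle C)) (rest (cycle C))
    ... | yes big = let (C′ , C′<C) = shortcutAtStart C big in unshortenable C′ (shorter C′<C)
    ... | no small
      with any? (λ x → x ∉? X ×-dec x ∉? vertices (cycle C)
                         ×-dec suc d <? degreeOn x (vertices (cycle C)))
    ...   | yes (x , x∉X , x∉C , big) =
      let (C′ , C′<C) = shortcutThrough C x∉X x∉C big in unshortenable C′ (shorter C′<C)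
    ...   | no none = C , ≮⇒≥ small , λ x∉X x∉C → ≮⇒≥ (λ big → none (_ , x∉X , x∉C , big))

    unshortenableFrom : ∀ {X} → ∃ (_∉ X) → (∀ {v} → v ∉ X → d ≤ degreeOutside X v) →
      Σ (LongCycleOutside X) (Unshortenable X ∘ cycle)
    unshortenableFrom (w , w∉X) deg = unshortenable C (<-wellFounded (cycleLength (cycle C)))
      where C = longCycleFrom w∉X deg

    module _ {X} (C : LongCycleOutside X) (C-unshortenable : Unshortenable X (cycle C))
             (r : ℕ) (deg : ∀ {v} → v ∉ X → d + suc r * suc d ≤ degreeOutside X v) where

      degreeAfterRemoving : ∀ {v} → v ∉ vertices (cycle C) ++ X →
        d + r * suc d ≤ degreeOutside (vertices (cycle C) ++ X) v
      degreeAfterRemoving {v} v∉CX = m+[n+o]≤p≤q+n⇒m+o≤q d (suc d) (r * suc d) (deg v∉X)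
        (≤-trans (degreeOutside-++ (vertices (cycle C)) X v)
                 (+-monoʳ-≤ _ (proj₂ C-unshortenable v∉X v∉C)))
        where
        v∉C = v∉CX ∘ ∈-++⁺ˡ
        v∉X = v∉CX ∘ ∈-++⁺ʳ (vertices (cycle C))

      vertexAfterRemoving : ∃ (_∉ vertices (cycle C) ++ X)
      vertexAfterRemoving = vertexOutside (vertices (cycle C) ++ X) s
        (≤-trans (s≤s z≤n)
          (m+[n+o]≤p≤q+n⇒m+o≤q 0 d (suc d + r * suc d) (deg (All.head (avoids C))) bound))
        where
        s = start (cycle C)
        bound : degreeOutside X s ≤ degreeOutside (vertices (cycle C) ++ X) s + d
        bound = ≤-trans (degreeOutside-++ (vertices (cycle C)) X s) (+-monoʳ-≤ _
          (subst (_≤ d) (≡.sym (degreeOn-∷⁻ (rest (cycle C)) Adj-irrefl)) (proj₁ C-unshortenable)))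

    DisjointLongCycles : ℕ → List (Fin n) → Set
    DisjointLongCycles k X = Σ (Fin k → Cycle G) λ C →
      (∀ i → d < cycleLength (C i)) × (∀ i j → i ≢ j → Disjoint (C i) (C j)) ×
      (∀ i → All (_∉ X) (vertices (C i)))

    noCycles : ∀ {X} → DisjointLongCycles 0 X
    noCycles = (λ ()) , (λ ()) , (λ ()) , (λ ())

    _◃_ : ∀ {X k} (C : LongCycleOutside X) → DisjointLongCycles k (vertices (cycle C) ++ X) →
      DisjointLongCycles (suc k) X
    _◃_ {X} {k} C (Ds , long , disjoint , avoid) = Cs , long′ , disjoint′ , avoid′
      where
      Cs : Fin (suc k) → Cycle G
      Cs zero    = cycle C
      Cs (suc i) = Ds i
      long′ : ∀ i → d < cycleLength (Cs i)
      long′ zero    = isLong C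
      long′ (suc i) = long i
      disjoint′ : ∀ i j → i ≢ j → Disjoint (Cs i) (Cs j)
      disjoint′ zero    zero    0≢0 = ⊥-elim (0≢0 refl)
      disjoint′ zero    (suc j) _ v v∈C v∈Dj = All.lookup (avoid j) v∈Dj (∈-++⁺ˡ v∈C)
      disjoint′ (suc i) zero    _ v v∈Di v∈C = All.lookup (avoid i) v∈Di (∈-++⁺ˡ v∈C)
      disjoint′ (suc i) (suc j) i≢j = disjoint i j (i≢j ∘ cong suc)
      avoid′ : ∀ i → All (_∉ X) (vertices (Cs i))
      avoid′ zero    = avoids C
      avoid′ (suc i) = All.map (_∘ ∈-++⁺ʳ (vertices (cycle C))) (avoid i)

    -- d + r * suc d is (r + 1)ℓ − 1.
    disjointLongCycles : ∀ r X → ∃ (_∉ X) → (∀ {v} → v ∉ X → d + r * suc d ≤ degreeOutside X v) →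
      DisjointLongCycles (suc r) X
    disjointLongCycles zero X w deg =
      proj₁ (unshortenableFrom w (λ v∉X → ≤-trans (m≤m+n d 0) (deg v∉X))) ◃ noCycles
    disjointLongCycles (suc r) X w deg =
      let (C , C-unshortenable) = unshortenableFrom w (λ v∉X → ≤-trans (m≤m+n d _) (deg v∉X))
      in C ◃ disjointLongCycles r (vertices (cycle C) ++ X)
               (vertexAfterRemoving C C-unshortenable r deg)
               (degreeAfterRemoving C C-unshortenable r deg)

lemma5 : (k ℓ : ℕ) → 1 ≤ k → 3 ≤ ℓ →
    (n : ℕ) → 0 < n → (G : Graph n) →
    (∀ v → k * ℓ ∸ 1 ≤ degree G v) →
    ∃ λ (C : Fin k → Cycle G) →
      (∀ i → ℓ ≤ cycleLength (C i)) ×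
      (∀ i j → i ≢ j → Disjoint (C i) (C j))
lemma5 (suc k) (suc d) _ (s≤s 2≤d) (suc n) _ G deg =
  let (C , long , disjoint , _) = disjointLongCycles G d 2≤d k [] (zero , λ ()) deg[]
  in C , long , disjoint
  where
  deg[] : ∀ {v} → v ∉ [] → d + k * suc d ≤ degreeOutside G [] v
  deg[] {v} _ = subst (d + k * suc d ≤_) (degree≡degreeOutside[] G v) (deg v)
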